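{- Let $q$ be a prime power and $k,v_1,v_2$ positive integers with $v_2\ge 2k$. Let $\mathcal{C}_1$ be a set of $k$-subspaces of $\mathbb{F}_q^{v_1}$ pairwise intersecting in dimension at most $1$, and $\mathcal{C}_1^C\subseteq\mathcal{C}_1$ a subset whose elements pairwise intersect trivially. Let $\mathcal{C}_2$ be a nonempty set of $k$-subspaces of $\mathbb{F}_q^{v_2}$ pairwise intersecting in dimension at most $1$, and let $S_2\le \mathbb{F}_q^{v_2}$ be a $(v_2-k)$-subspace such that exactly $\Lambda$ elements of $\mathcal{C}_2$ lie in $S_2$ and all others meet $S_2$ in dimension at most $1$. Let $\mathcal{C}$ be a set of $k$-subspaces of $\mathbb{F}_q^{v_1+v_2-k}$ obtained by the following construction: embed $\mathbb{F}_q^{v_1}$ (and hence $\mathcal{C}_1$) into $\mathbb{F}_q^{v_1+v_2-k}$ and choose a $(v_2-k)$-subspace $S$ of $\mathbb{F}_q^{v_1+v_2-k}$ intersecting the span of $\mathcal{C}_1$ trivially; for each $U\in\mathcal{C}_1$ put $K_U=\langle U,S\rangle$ (a $v_2$-space). For each $U\in\mathcal{C}_1^C$, choose a linear isomorphism $\varphi_U:\mathbb{F}_q^{v_2}\to K_U$ with $\varphi_U(S_2)=S$ and $U\in\{\varphi_U(W):W\in\mathcal{C}_2\}$, and add to $\mathcal{C}$ all $\varphi_U(W)$ with $W\in\mathcal{C}_2$, $W\not\le S_2$. For each $U\in\mathcal{C}_1\setminus\mathcal{C}_1^C$, add to $\mathcal{C}$ a set of $q^{2(v_2-k)}$ $k$-subspaces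 of $K_U$ (a lifted maximum rank distance code) containing $U$, pairwise intersecting in dimension at most $1$, each intersecting $S$ trivially. Finally add to $\mathcal{C}$ $\Lambda$ $k$-subspaces of $S$ pairwise intersecting in dimension at most $1$ (images of the elements of $\mathcal{C}_2$ contained in $S_2$). Suppose $\mathcal{C}_2$ contains a subset $\mathcal{C}_2^C$ whose elements pairwise intersect trivially and each intersect $S_2$ trivially. Then $\mathcal{C}$ contains a subset $\mathcal{C}'$ whose elements pairwise intersect trivially, with $\#\mathcal{C}'=\#\mathcal{C}_1^C\cdot\#\mathcal{C}_2^C$.
   Context: A $k$-subspace means a $k$-dimensional $\mathbb{F}_q$-linear subspace. Two subspaces intersect trivially if their intersection is the zero subspace. -}

module Defs where

open import Level using (0ℓ)
open import Data.Nat as ℕ using (ℕ; zero; suc; _≤_; _∸_; _^_)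
open import Data.Nat.Primality using (Prime)
open import Data.Fin using (Fin; zero; suc)
open import Data.Bool using (Bool; true; false)
open import Data.Product using (Σ; ∃; _×_; _,_)
open import Data.Sum using (_⊎_)
open import Relation.Binary.PropositionalEquality using (_≡_; _≢_)
open import Relation.Nullary using (¬_)
open import Algebra.Structures using (IsCommutativeRing)
open import Function.Bundles using (_↔_)
open import Data.Unit using (⊤)


IsPrimePower : ℕ → Set
IsPrimePower q = Σ ℕ λ p → Σ ℕ λ e → Prime p × (1 ≤ e) × (q ≡ p ^ e)

record FiniteField (q : ℕ) : Set₁ where
  infixl 6 _+_
  infixl 7 _*_
  field
    F       : Set
    0# 1#   : F
    _+_ _*_ : F → F → F
    -_      : F → F
    isCommutativeRing : IsCommutativeRing _≡_ _+_ _*_ -_ 0# 1#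
    0≢1     : 0# ≢ 1#
    inverse : ∀ x → x ≢ 0# → ∃ λ y → x * y ≡ 1#
    card    : F ↔ Fin q

count : ∀ {m} → (Fin m → Bool) → ℕ
count {zero}  b = zero
count {suc m} b with b zero
... | true  = suc (count (λ i → b (suc i)))
... | false = count (λ i → b (suc i))

module LinAlg {q : ℕ} (𝔽 : FiniteField q) where
  open FiniteField 𝔽

  V : ℕ → Set
  V n = Fin n → F

  _≋_ : ∀ {n} → V n → V n → Set
  x ≋ y = ∀ i → x i ≡ y i

  0v : ∀ {n} → V n
  0v _ = 0#

  _+v_ : ∀ {n} → V n → V n → V n
  (x +v y) i = x i + y i

  _·_ : ∀ {n} → F → V n → V n
  (c · x) i = c * x i

  Σv : ∀ {m n} → (Fin m → V n) → V n
  Σv {zero}  u = 0v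
  Σv {suc m} u = u zero +v Σv (λ i → u (suc i))

  lincomb : ∀ {m n} → (Fin m → F) → (Fin m → V n) → V n
  lincomb a b = Σv (λ i → a i · b i)

  LinIndep : ∀ {m n} → (Fin m → V n) → Set
  LinIndep b = ∀ a → lincomb a b ≋ 0v → ∀ i → a i ≡ 0#

  VSet : ℕ → Set₁
  VSet n = V n → Set

  record IsSubspace {n} (P : VSet n) : Set where
    field
      resp  : ∀ {x y} → x ≋ y → P x → P y
      zero∈ : P 0v
      +∈    : ∀ {x y} → P x → P y → P (x +v y)
      ·∈    : ∀ c {x} → P x → P (c · x)

  Subspace : ℕ → Set₁
  Subspace n = Σ (VSet n) IsSubspace

  ⟦_⟧ : ∀ {n} → Subspace n → VSet n
  ⟦ P , _ ⟧ = P

  _⊆_ : ∀ {n} → VSet n → VSet n → Set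
  P ⊆ Q = ∀ x → P x → Q x

  _≐_ : ∀ {n} → VSet n → VSet n → Set
  P ≐ Q = P ⊆ Q × Q ⊆ P

  _∩_ : ∀ {n} → VSet n → VSet n → VSet n
  (P ∩ Q) x = P x × Q x

  _⊕_ : ∀ {n} → VSet n → VSet n → VSet n
  (P ⊕ Q) x = Σ _ λ a → Σ _ λ b → P a × Q b × (x ≋ (a +v b))

  SpanFam : ∀ {m n} → (Fin m → VSet n) → VSet n
  SpanFam P x = Σ _ λ u → (∀ i → P i (u i)) × (x ≋ Σv u)

  HasDim : ∀ {n} → VSet n → ℕ → Set
  HasDim {n} P k = Σ (Fin k → V n) λ b →
    (∀ i → P (b i)) × LinIndep b × (∀ x → P x → Σ (Fin k → F) λ a → x ≋ lincomb a b)

  DimAtMost : ∀ {n} → VSet n → ℕ → Set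
  DimAtMost {n} P d = ∀ m (b : Fin m → V n) → (∀ i → P (b i)) → LinIndep b → m ≤ d

  Trivial : ∀ {n} → VSet n → VSet n → Set
  Trivial P Q = ∀ x → P x → Q x → x ≋ 0v

  IsKSub : ∀ {n} → ℕ → Subspace n → Set
  IsKSub k U = HasDim ⟦ U ⟧ k

  -- a finite family indexes a *set* of subspaces (distinct members)
  Distinct : ∀ {m n} → (Fin m → Subspace n) → Set
  Distinct C = ∀ i j → i ≢ j → ¬ (⟦ C i ⟧ ≐ ⟦ C j ⟧)

  PairwiseDimLe1 : ∀ {m n} → (Fin m → Subspace n) → Set
  PairwiseDimLe1 C = ∀ i j → i ≢ j → DimAtMost (⟦ C i ⟧ ∩ ⟦ C j ⟧) 1

  record IsLinear {a b} (f : V a → V b) : Set where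
    field
      resp : ∀ {x y} → x ≋ y → f x ≋ f y
      +hom : ∀ x y → f (x +v y) ≋ (f x +v f y)
      ·hom : ∀ c x → f (c · x) ≋ (c · f x)

  InjectiveLinear : ∀ {a b} → (V a → V b) → Set
  InjectiveLinear f = IsLinear f × (∀ x y → f x ≋ f y → x ≋ y)

  Img : ∀ {a b} → (V a → V b) → VSet a → VSet b
  Img f P y = Σ _ λ x → P x × (f x ≋ y)

  -- 𝒞₁ ⊆ {k-subspaces of 𝔽_q^{v₁}}, pairwise meeting in dim ≤ 1,
  -- with the subset 𝒞₁ᶜ = {C₁ i | inC₁ᶜ i ≡ true} pairwise meeting trivially
  record Code1 (k v₁ : ℕ) : Set₁ where
    field
      m₁     : ℕ
      C₁     : Fin m₁ → Subspace v₁
      kSub₁  : ∀ i → IsKSub k (C₁ i)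
      dist₁  : Distinct C₁
      pw₁    : PairwiseDimLe1 C₁
      inC₁ᶜ  : Fin m₁ → Bool
      triv₁ᶜ : ∀ i j → i ≢ j → inC₁ᶜ i ≡ true → inC₁ᶜ j ≡ true →
               Trivial ⟦ C₁ i ⟧ ⟦ C₁ j ⟧

  -- 𝒞₂ (nonempty) of k-subspaces of 𝔽_q^{v₂}, pairwise meeting in dim ≤ 1,
  -- and a (v₂-k)-subspace S₂ containing exactly Λ elements of 𝒞₂
  -- (those with inS₂ j ≡ true), all others meeting S₂ in dim ≤ 1
  record Code2 (k v₂ : ℕ) : Set₁ where
    field
      m₂      : ℕ
      nonempty : 1 ≤ m₂
      C₂      : Fin m₂ → Subspace v₂
      kSub₂   : ∀ j → IsKSub k (C₂ j)
      dist₂   : Distinct C₂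
      pw₂     : PairwiseDimLe1 C₂
      S₂      : Subspace v₂
      dimS₂   : HasDim ⟦ S₂ ⟧ (v₂ ∸ k)
      Λ       : ℕ
      inS₂    : Fin m₂ → Bool
      inS₂-sound    : ∀ j → inS₂ j ≡ true → ⟦ C₂ j ⟧ ⊆ ⟦ S₂ ⟧
      inS₂-complete : ∀ j → ⟦ C₂ j ⟧ ⊆ ⟦ S₂ ⟧ → inS₂ j ≡ true
      countΛ  : count inS₂ ≡ Λ
      others  : ∀ j → inS₂ j ≡ false → DimAtMost (⟦ C₂ j ⟧ ∩ ⟦ S₂ ⟧) 1

  record Construction (k v₁ v₂ : ℕ) (𝒞₁ : Code1 k v₁) (𝒞₂ : Code2 k v₂) : Set₁ where
    open Code1 𝒞₁
    open Code2 𝒞₂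
    N : ℕ
    N = v₁ ℕ.+ (v₂ ∸ k)
    field
      ι     : V v₁ → V N
      ι-inj : InjectiveLinear ι
      S     : Subspace N
      dimS  : HasDim ⟦ S ⟧ (v₂ ∸ k)
      S-triv : Trivial (SpanFam (λ i → Img ι ⟦ C₁ i ⟧)) ⟦ S ⟧
    K : Fin m₁ → VSet N
    K i = Img ι ⟦ C₁ i ⟧ ⊕ ⟦ S ⟧
    field
      φ      : ∀ i → inC₁ᶜ i ≡ true → V v₂ → V N
      φ-inj  : ∀ i p → InjectiveLinear (φ i p)
      φ-onto : ∀ i p → Img (φ i p) (λ _ → ⊤) ≐ K i
      φS₂    : ∀ i p → Img (φ i p) ⟦ S₂ ⟧ ≐ ⟦ S ⟧
      φU     : ∀ i p → Σ (Fin m₂) λ j → Img ι ⟦ C₁ i ⟧ ≐ Img (φ i p) ⟦ C₂ j ⟧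
      M      : ∀ i → inC₁ᶜ i ≡ false → Fin (q ^ (2 ℕ.* (v₂ ∸ k))) → Subspace N
      M-kSub : ∀ i p t → IsKSub k (M i p t)
      M-dist : ∀ i p → Distinct (M i p)
      M-pw   : ∀ i p → PairwiseDimLe1 (M i p)
      M-K    : ∀ i p t → ⟦ M i p t ⟧ ⊆ K i
      M-S    : ∀ i p t → Trivial ⟦ M i p t ⟧ ⟦ S ⟧
      M-U    : ∀ i p → Σ _ λ t → ⟦ M i p t ⟧ ≐ Img ι ⟦ C₁ i ⟧
      T      : Fin Λ → Subspace N
      T-kSub : ∀ t → IsKSub k (T t)
      T-dist : Distinct T
      T-pw   : PairwiseDimLe1 T
      T-S    : ∀ t → ⟦ T t ⟧ ⊆ ⟦ S ⟧
    InC : VSet N → Set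
    InC X =
        (Σ (Fin m₁) λ i → Σ (inC₁ᶜ i ≡ true) λ p → Σ (Fin m₂) λ j →
           (inS₂ j ≡ false) × (X ≐ Img (φ i p) ⟦ C₂ j ⟧))
      ⊎ (Σ (Fin m₁) λ i → Σ (inC₁ᶜ i ≡ false) λ p → Σ _ λ t → X ≐ ⟦ M i p t ⟧)
      ⊎ (Σ (Fin Λ) λ t → X ≐ ⟦ T t ⟧)

module Submission where

-- Lemma 5: the construction 𝒞 contains #𝒞₁ᶜ · #𝒞₂ᶜ pairwise trivially
-- intersecting members, namely the blocks φ_U(W) with U ∈ 𝒞₁ᶜ, W ∈ 𝒞₂ᶜ.
--
-- Two blocks φ_U(W), φ_U(W') over the same U meet trivially because φ_U is
-- injective and W ∩ W' = 0.  Two blocks over different U, U' ∈ 𝒞₁ᶜ lie in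
-- K_U = U ⊕ S and K_U' = U' ⊕ S; since U ∩ U' = 0 and S meets the span of
-- 𝒞₁ trivially, K_U ∩ K_U' ⊆ S.  But φ_U(W) ∩ S = φ_U(W ∩ S₂) = 0, so these
-- blocks meet trivially as well.  Members of 𝒞₂ᶜ are not contained in S₂,
-- so every block really is a member of 𝒞; pairwise trivial nonzero
-- subspaces are distinct, so the blocks form a set of the stated size.

open import Defs
open import Data.Nat using (ℕ; _≤_; _*_)
open import Data.Fin using (Fin)
open import Data.Bool using (Bool; true)
open import Data.Product using (Σ; _×_)
open import Relation.Binary.PropositionalEquality using (_≡_; _≢_)

open import Level using (0ℓ)
open import Algebra.Bundles using (CommutativeRing)
open import Axiom.UniquenessOfIdentityProofs using (module Decidable⇒UIP)
open import Data.Nat using (zero; suc)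
open import Data.Fin using (zero; suc; remQuot; combine; _≟_)
open import Data.Fin.Properties using (combine-remQuot; suc-injective)
open import Data.Bool using (false)
open import Data.Bool.Properties using () renaming (_≟_ to _≟ᵇ_)
open import Data.Product using (_,_; proj₁; proj₂; uncurry)
open import Data.Sum using (inj₁)
open import Data.Unit using (tt)
open import Relation.Nullary using (¬_; yes; no; contradiction)
open import Relation.Binary.PropositionalEquality
  using (refl; sym; trans; cong; cong₂; module ≡-Reasoning)

-- Scalar identities used to subtract two decompositions x = u + s = u' + s'.
module FieldFacts {q : ℕ} (𝔽 : FiniteField q) where
  open FiniteField 𝔽 renaming (_*_ to _⊛_)

  ring : CommutativeRing 0ℓ 0ℓ
  ring = record { isCommutativeRing = isCommutativeRing }

  open import Algebra.Properties.AbelianGroup (CommutativeRing.+-abelianGroup ring)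
    using (xyx⁻¹≈y; x∙y⁻¹≈ε⇒x≈y)
  open import Algebra.Properties.Ring (CommutativeRing.ring ring) using (-1*x≈-x)
  open CommutativeRing ring using (+-comm; +-assoc)
  open ≡-Reasoning

  difference-swap : ∀ a b c d → a + b ≡ c + d → a + (- 1#) ⊛ c ≡ d + (- 1#) ⊛ b
  difference-swap a b c d e = begin
    a + (- 1#) ⊛ c          ≡⟨ cong (a +_) (-1*x≈-x c) ⟩
    a + - c                 ≡⟨ sym (xyx⁻¹≈y b (a + - c)) ⟩
    b + (a + - c) + - b     ≡⟨ cong (_+ - b) (sym (+-assoc b a (- c))) ⟩
    b + a + - c + - b       ≡⟨ cong (λ w → w + - c + - b) (trans (+-comm b a) e) ⟩
    c + d + - c + - b       ≡⟨ cong (_+ - b) (xyx⁻¹≈y c d) ⟩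
    d + - b                 ≡⟨ cong (d +_) (sym (-1*x≈-x b)) ⟩
    d + (- 1#) ⊛ b          ∎

  difference-zero : ∀ a b → a + (- 1#) ⊛ b ≡ 0# → a ≡ b
  difference-zero a b e = x∙y⁻¹≈ε⇒x≈y a b (trans (cong (a +_) (sym (-1*x≈-x b))) e)

module SubspaceFacts {q : ℕ} (𝔽 : FiniteField q) where
  open FiniteField 𝔽 renaming (_*_ to _⊛_)
  open LinAlg 𝔽
  open FieldFacts 𝔽 using (ring; difference-swap; difference-zero)
  open CommutativeRing ring using (zeroˡ; *-identityˡ; +-identityˡ; +-identityʳ)
  open import Algebra.Properties.CommutativeSemigroup (CommutativeRing.+-commutativeSemigroup ring)
    using (interchange)

  ≋-sym : ∀ {n} {x y : V n} → x ≋ y → y ≋ x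
  ≋-sym e i = sym (e i)

  ≋-trans : ∀ {n} {x y z : V n} → x ≋ y → y ≋ z → x ≋ z
  ≋-trans e f i = trans (e i) (f i)

  -- a linear map sends 0 to 0 (f 0 = f (0 · 0) = 0 · f 0)
  linear-zero : ∀ {a b} {f : V a → V b} → IsLinear f → f 0v ≋ 0v
  linear-zero f-lin i = trans (IsLinear.resp f-lin (λ _ → sym (zeroˡ 0#)) i)
                              (trans (IsLinear.·hom f-lin 0# 0v i) (zeroˡ _))

  injective-kernel : ∀ {a b} {f : V a → V b} → InjectiveLinear f →
                     ∀ x → f x ≋ 0v → x ≋ 0v
  injective-kernel (f-lin , f-inj) x fx≋0 =
    f-inj x 0v (≋-trans fx≋0 (≋-sym (linear-zero f-lin)))

  image-subspace : ∀ {a b} {f : V a → V b} {P : VSet a} →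
                   IsLinear f → IsSubspace P → IsSubspace (Img f P)
  image-subspace f-lin P-sub = record
    { resp  = λ { e (x , px , fx) → x , px , ≋-trans fx e }
    ; zero∈ = 0v , IsSubspace.zero∈ P-sub , linear-zero f-lin
    ; +∈    = λ { (x , px , fx) (y , py , fy) →
                  x +v y , IsSubspace.+∈ P-sub px py ,
                  (λ i → trans (IsLinear.+hom f-lin x y i) (cong₂ _+_ (fx i) (fy i))) }
    ; ·∈    = λ { c (x , px , fx) →
                  c · x , IsSubspace.·∈ P-sub c px ,
                  (λ i → trans (IsLinear.·hom f-lin c x i) (cong (c ⊛_) (fx i))) }
    }

  trivial-mono : ∀ {n} {P P′ Q Q′ : VSet n} →
                 P′ ⊆ P → Q′ ⊆ Q → Trivial P Q → Trivial P′ Q′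
  trivial-mono P′⊆P Q′⊆Q PQ x p q = PQ x (P′⊆P x p) (Q′⊆Q x q)

  -- injective linear maps preserve trivial intersections: f(P) ∩ f(Q) = f(P ∩ Q)
  image-trivial : ∀ {a b} {f : V a → V b} {P Q : VSet a} →
                  InjectiveLinear f → IsSubspace Q → Trivial P Q →
                  Trivial (Img f P) (Img f Q)
  image-trivial f-inj Q-sub PQ x (a , pa , fa≋x) (b , qb , fb≋x) =
    ≋-trans (≋-sym fa≋x) (≋-trans (IsLinear.resp (proj₁ f-inj) a≋0) (linear-zero (proj₁ f-inj)))
    where
    a≋b : a ≋ b
    a≋b = proj₂ f-inj a b (≋-trans fa≋x (≋-sym fb≋x))
    a≋0 : a ≋ 0v
    a≋0 = PQ a pa (IsSubspace.resp Q-sub (≋-sym a≋b) qb)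

  Σv-zero : ∀ {m n} (u : Fin m → V n) → (∀ l → u l ≋ 0v) → Σv u ≋ 0v
  Σv-zero {zero}  u h i = refl
  Σv-zero {suc m} u h i =
    trans (cong₂ _+_ (h zero i) (Σv-zero (λ l → u (suc l)) (λ l → h (suc l)) i)) (+-identityʳ 0#)

  -- a subspace of positive dimension contains a nonzero vector: the first
  -- basis vector b₀, since b₀ = 0 would give the dependency 1 · b₀ = 0
  nonzero-vector : ∀ {n k} {P : VSet n} → 1 ≤ k → HasDim P k →
                   Σ (V n) λ x → P x × ¬ (x ≋ 0v)
  nonzero-vector {k = suc k} _ (b , b∈P , b-indep , _) =
    b zero , b∈P zero , λ b₀≋0 → 0≢1 (sym (b-indep first (b₀-only b₀≋0) zero))
    where
    first : Fin (suc k) → F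
    first zero    = 1#
    first (suc _) = 0#
    rest≋0 : Σv (λ l → first (suc l) · b (suc l)) ≋ 0v
    rest≋0 = Σv-zero (λ l → first (suc l) · b (suc l)) (λ l j → zeroˡ _)
    b₀-only : b zero ≋ 0v → lincomb first b ≋ 0v
    b₀-only b₀≋0 i =
      trans (cong₂ _+_ (trans (*-identityˡ _) (b₀≋0 i)) (rest≋0 i)) (+-identityʳ 0#)

  trivial-not-contained : ∀ {n} {P Q : VSet n} → Σ (V n) (λ x → P x × ¬ (x ≋ 0v)) →
                          Trivial P Q → ¬ (P ⊆ Q)
  trivial-not-contained (x , px , x≢0) PQ P⊆Q = x≢0 (PQ x px (P⊆Q x px))

  trivial-distinct : ∀ {m n} (C : Fin m → Subspace n) →
                     (∀ s → Σ (V n) λ x → ⟦ C s ⟧ x × ¬ (x ≋ 0v)) →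
                     (∀ s t → s ≢ t → Trivial ⟦ C s ⟧ ⟦ C t ⟧) → Distinct C
  trivial-distinct C nonzero triv s t s≢t (Cs⊆Ct , _) =
    trivial-not-contained (nonzero s) (triv s t s≢t) Cs⊆Ct

  single : ∀ {m n} → Fin m → V n → Fin m → V n
  single zero    a zero    = a
  single zero    a (suc _) = 0v
  single (suc _) a zero    = 0v
  single (suc i) a (suc l) = single i a l

  single∈ : ∀ {m n} (P : Fin m → VSet n) → (∀ l → IsSubspace (P l)) →
            ∀ i {a} → P i a → ∀ l → P l (single i a l)
  single∈ P P-sub zero    pa zero    = pa
  single∈ P P-sub zero    pa (suc l) = IsSubspace.zero∈ (P-sub (suc l))
  single∈ P P-sub (suc i) pa zero    = IsSubspace.zero∈ (P-sub zero)
  single∈ P P-sub (suc i) pa (suc l) = single∈ (λ l → P (suc l)) (λ l → P-sub (suc l)) i pa l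

  Σv-single : ∀ {m n} (i : Fin m) (a : V n) → Σv (single i a) ≋ a
  Σv-single {suc m} zero a j =
    trans (cong (a j +_) (Σv-zero {m} (λ l → single zero a (suc l)) (λ l i → refl) j)) (+-identityʳ _)
  Σv-single (suc i) a j = trans (+-identityˡ _) (Σv-single i a j)

  Σv-+ : ∀ {m n} (u w : Fin m → V n) → Σv (λ l → u l +v w l) ≋ (Σv u +v Σv w)
  Σv-+ {zero}  u w j = sym (+-identityʳ 0#)
  Σv-+ {suc m} u w j =
    trans (cong (_ +_) (Σv-+ (λ l → u (suc l)) (λ l → w (suc l)) j)) (interchange _ _ _ _)

  pair-in-span : ∀ {m n} (P : Fin m → VSet n) → (∀ l → IsSubspace (P l)) →
                 ∀ i j {a b} → P i a → P j b → SpanFam P (a +v b)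
  pair-in-span P P-sub i j {a} {b} pa pb =
    (λ l → single i a l +v single j b l) ,
    (λ l → IsSubspace.+∈ (P-sub l) (single∈ P P-sub i pa l) (single∈ P P-sub j pb l)) ,
    ≋-sym (≋-trans (Σv-+ (single i a) (single j b))
                   (λ l → cong₂ _+_ (Σv-single i a l) (Σv-single j b l)))

  -- If S meets the span of a family trivially and P i ∩ P j = 0, then
  -- (P i ⊕ S) ∩ (P j ⊕ S) ⊆ S: from x = u + s = u′ + s′ we get
  -- u − u′ = s′ − s ∈ span ∩ S = 0, so u = u′ ∈ P i ∩ P j = 0 and x = s.
  sums-meet-in : ∀ {m n} (P : Fin m → VSet n) → (∀ l → IsSubspace (P l)) →
                 (S : Subspace n) → Trivial (SpanFam P) ⟦ S ⟧ →
                 ∀ i j → Trivial (P i) (P j) →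
                 ∀ x → (P i ⊕ ⟦ S ⟧) x → (P j ⊕ ⟦ S ⟧) x → ⟦ S ⟧ x
  sums-meet-in {n = n} P P-sub (S , S-sub) span∩S i j PiPj x
               (u , s , pu , s∈S , x≋u+s) (u′ , s′ , pu′ , s′∈S , x≋u′+s′) =
    IsSubspace.resp S-sub (≋-sym x≋s) s∈S
    where
    d : V n
    d = u +v ((- 1#) · u′)
    d∈span : SpanFam P d
    d∈span = pair-in-span P P-sub i j pu (IsSubspace.·∈ (P-sub j) (- 1#) pu′)
    d∈S : S d
    d∈S = IsSubspace.resp S-sub
      (λ l → sym (difference-swap (u l) (s l) (u′ l) (s′ l) (trans (sym (x≋u+s l)) (x≋u′+s′ l))))
      (IsSubspace.+∈ S-sub s′∈S (IsSubspace.·∈ S-sub (- 1#) s∈S))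
    u≋u′ : u ≋ u′
    u≋u′ l = difference-zero (u l) (u′ l) (span∩S d d∈span d∈S l)
    u≋0 : u ≋ 0v
    u≋0 = PiPj u pu (IsSubspace.resp (P-sub j) (≋-sym u≋u′) pu′)
    x≋s : x ≋ s
    x≋s l = trans (x≋u+s l) (trans (cong (_+ s l) (u≋0 l)) (+-identityˡ _))

enum : ∀ {m} (b : Fin m → Bool) → Fin (count b) → Fin m
enum {suc m} b s with b zero
enum {suc m} b zero    | true  = zero
enum {suc m} b (suc s) | true  = suc (enum (λ i → b (suc i)) s)
enum {suc m} b s       | false = suc (enum (λ i → b (suc i)) s)

enum-true : ∀ {m} (b : Fin m → Bool) (s : Fin (count b)) → b (enum b s) ≡ true
enum-true {suc m} b s with b zero in b₀
enum-true {suc m} b zero    | true  = b₀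
enum-true {suc m} b (suc s) | true  = enum-true (λ i → b (suc i)) s
enum-true {suc m} b s       | false = enum-true (λ i → b (suc i)) s

enum-injective : ∀ {m} (b : Fin m → Bool) (s t : Fin (count b)) → enum b s ≡ enum b t → s ≡ t
enum-injective {suc m} b s t e with b zero
enum-injective {suc m} b zero    zero    e | true  = refl
enum-injective {suc m} b (suc s) (suc t) e | true  = cong suc (enum-injective (λ i → b (suc i)) s t (suc-injective e))
enum-injective {suc m} b s       t       e | false = enum-injective (λ i → b (suc i)) s t (suc-injective e)

enum-pairs : ∀ {m₁ m₂} (b₁ : Fin m₁ → Bool) (b₂ : Fin m₂ → Bool) →
             Fin (count b₁ * count b₂) → Fin m₁ × Fin m₂
enum-pairs b₁ b₂ s = enum b₁ (proj₁ r) , enum b₂ (proj₂ r)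
  where
  r : Fin (count b₁) × Fin (count b₂)
  r = remQuot {count b₁} (count b₂) s

enum-pairs-true : ∀ {m₁ m₂} (b₁ : Fin m₁ → Bool) (b₂ : Fin m₂ → Bool) s →
                  b₁ (proj₁ (enum-pairs b₁ b₂ s)) ≡ true × b₂ (proj₂ (enum-pairs b₁ b₂ s)) ≡ true
enum-pairs-true b₁ b₂ s = enum-true b₁ (proj₁ r) , enum-true b₂ (proj₂ r)
  where
  r : Fin (count b₁) × Fin (count b₂)
  r = remQuot {count b₁} (count b₂) s

enum-pairs-injective : ∀ {m₁ m₂} (b₁ : Fin m₁ → Bool) (b₂ : Fin m₂ → Bool) s t →
                       enum-pairs b₁ b₂ s ≡ enum-pairs b₁ b₂ t → s ≡ t
enum-pairs-injective b₁ b₂ s t e = begin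
  s                                                 ≡⟨ sym (combine-remQuot {count b₁} (count b₂) s) ⟩
  uncurry combine (remQuot {count b₁} (count b₂) s) ≡⟨ cong (uncurry combine) same-remQuot ⟩
  uncurry combine (remQuot {count b₁} (count b₂) t) ≡⟨ combine-remQuot {count b₁} (count b₂) t ⟩
  t                                                 ∎
  where
  open ≡-Reasoning
  same-remQuot : remQuot {count b₁} (count b₂) s ≡ remQuot {count b₁} (count b₂) t
  same-remQuot = cong₂ _,_ (enum-injective b₁ _ _ (cong proj₁ e)) (enum-injective b₂ _ _ (cong proj₂ e))

module Blocks {q : ℕ} (𝔽 : FiniteField q) (k v₁ v₂ : ℕ) (1≤k : 1 ≤ k)
  (𝒞₁ : LinAlg.Code1 𝔽 k v₁) (𝒞₂ : LinAlg.Code2 𝔽 k v₂)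
  (𝒞 : LinAlg.Construction 𝔽 k v₁ v₂ 𝒞₁ 𝒞₂)
  (inC₂ᶜ : Fin (LinAlg.Code2.m₂ 𝒞₂) → Bool)
  (C₂ᶜ-trivial : ∀ j j′ → j ≢ j′ → inC₂ᶜ j ≡ true → inC₂ᶜ j′ ≡ true →
    LinAlg.Trivial 𝔽 (LinAlg.⟦_⟧ 𝔽 (LinAlg.Code2.C₂ 𝒞₂ j)) (LinAlg.⟦_⟧ 𝔽 (LinAlg.Code2.C₂ 𝒞₂ j′)))
  (C₂ᶜ-S₂-trivial : ∀ j → inC₂ᶜ j ≡ true →
    LinAlg.Trivial 𝔽 (LinAlg.⟦_⟧ 𝔽 (LinAlg.Code2.C₂ 𝒞₂ j)) (LinAlg.⟦_⟧ 𝔽 (LinAlg.Code2.S₂ 𝒞₂)))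
  where
  open LinAlg 𝔽
  open SubspaceFacts 𝔽
  open Code1 𝒞₁
  open Code2 𝒞₂
  open Construction 𝒞
  open Decidable⇒UIP _≟ᵇ_ using () renaming (≡-irrelevant to bool-proof-irrelevant)

  block : ∀ i → inC₁ᶜ i ≡ true → Fin m₂ → Subspace N
  block i p j = Img (φ i p) ⟦ C₂ j ⟧ , image-subspace (proj₁ (φ-inj i p)) (proj₂ (C₂ j))

  block-nonzero : ∀ i p j → Σ (V N) λ x → ⟦ block i p j ⟧ x × ¬ (x ≋ 0v)
  block-nonzero i p j with nonzero-vector 1≤k (kSub₂ j)
  ... | x , x∈W , x≢0 =
    φ i p x , (x , x∈W , λ _ → refl) , λ φx≋0 → x≢0 (injective-kernel (φ-inj i p) x φx≋0)

  -- φ_U(W) ⊆ φ_U(𝔽_q^{v₂}) = K_U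
  block⊆K : ∀ i p j → ⟦ block i p j ⟧ ⊆ K i
  block⊆K i p j x (w , _ , φw≋x) = proj₁ (φ-onto i p) x (w , tt , φw≋x)

  -- φ_U(W) ∩ S = φ_U(W ∩ S₂) = 0, because φ_U(S₂) = S
  block-meets-S-trivially : ∀ i p j → inC₂ᶜ j ≡ true → Trivial ⟦ block i p j ⟧ ⟦ S ⟧
  block-meets-S-trivially i p j c =
    trivial-mono (λ _ x∈B → x∈B) (proj₂ (φS₂ i p))
      (image-trivial (φ-inj i p) (proj₂ S₂) (C₂ᶜ-S₂-trivial j c))

  K-meet-in-S : ∀ i i′ → i ≢ i′ → inC₁ᶜ i ≡ true → inC₁ᶜ i′ ≡ true →
                ∀ x → K i x → K i′ x → ⟦ S ⟧ x
  K-meet-in-S i i′ i≢i′ p p′ =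
    sums-meet-in (λ l → Img ι ⟦ C₁ l ⟧) (λ l → image-subspace (proj₁ ι-inj) (proj₂ (C₁ l)))
      S S-triv i i′ (image-trivial ι-inj (proj₂ (C₁ i′)) (triv₁ᶜ i i′ i≢i′ p p′))

  same-U-trivial : ∀ i p j j′ → j ≢ j′ → inC₂ᶜ j ≡ true → inC₂ᶜ j′ ≡ true →
                   Trivial ⟦ block i p j ⟧ ⟦ block i p j′ ⟧
  same-U-trivial i p j j′ j≢j′ c c′ =
    image-trivial (φ-inj i p) (proj₂ (C₂ j′)) (C₂ᶜ-trivial j j′ j≢j′ c c′)

  -- a common vector of blocks over U ≠ U′ lies in K_U ∩ K_U′ ⊆ S, hence is 0
  distinct-U-trivial : ∀ i i′ p p′ j j′ → i ≢ i′ → inC₂ᶜ j ≡ true →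
                       Trivial ⟦ block i p j ⟧ ⟦ block i′ p′ j′ ⟧
  distinct-U-trivial i i′ p p′ j j′ i≢i′ c x x∈B x∈B′ =
    block-meets-S-trivially i p j c x x∈B
      (K-meet-in-S i i′ i≢i′ p p′ x (block⊆K i p j x x∈B) (block⊆K i′ p′ j′ x x∈B′))

  blocks-trivial : ∀ i i′ p p′ j j′ → (i , j) ≢ (i′ , j′) →
                   inC₂ᶜ j ≡ true → inC₂ᶜ j′ ≡ true →
                   Trivial ⟦ block i p j ⟧ ⟦ block i′ p′ j′ ⟧
  blocks-trivial i i′ p p′ j j′ pairs≢ c c′ with i ≟ i′
  ... | no i≢i′ = distinct-U-trivial i i′ p p′ j j′ i≢i′ c
  ... | yes refl with refl ← bool-proof-irrelevant p p′ =
    same-U-trivial i p j j′ (λ j≡j′ → pairs≢ (cong (i ,_) j≡j′)) c c′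

  -- a member of 𝒞₂ᶜ is nonzero and meets S₂ trivially, so it is not inside S₂
  not-in-S₂ : ∀ j → inC₂ᶜ j ≡ true → inS₂ j ≡ false
  not-in-S₂ j c with inS₂ j in W⊆S₂
  ... | false = refl
  ... | true  = contradiction (inS₂-sound j W⊆S₂)
                  (trivial-not-contained (nonzero-vector 1≤k (kSub₂ j)) (C₂ᶜ-S₂-trivial j c))

  block-in-𝒞 : ∀ i p j → inC₂ᶜ j ≡ true → InC ⟦ block i p j ⟧
  block-in-𝒞 i p j c = inj₁ (i , p , j , not-in-S₂ j c , (λ _ x∈B → x∈B) , (λ _ x∈B → x∈B))

lemma5 : (q : ℕ) → IsPrimePower q → (𝔽 : FiniteField q) →
    (k v₁ v₂ : ℕ) → 1 ≤ k → 1 ≤ v₁ → 1 ≤ v₂ → 2 * k ≤ v₂ →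
    (𝒞₁ : LinAlg.Code1 𝔽 k v₁) → (𝒞₂ : LinAlg.Code2 𝔽 k v₂) →
    (𝒞 : LinAlg.Construction 𝔽 k v₁ v₂ 𝒞₁ 𝒞₂) →
    (inC₂ᶜ : Fin (LinAlg.Code2.m₂ 𝒞₂) → Bool) →
    (∀ i j → i ≢ j → inC₂ᶜ i ≡ true → inC₂ᶜ j ≡ true →
      LinAlg.Trivial 𝔽 (LinAlg.⟦_⟧ 𝔽 (LinAlg.Code2.C₂ 𝒞₂ i)) (LinAlg.⟦_⟧ 𝔽 (LinAlg.Code2.C₂ 𝒞₂ j))) →
    (∀ j → inC₂ᶜ j ≡ true →
      LinAlg.Trivial 𝔽 (LinAlg.⟦_⟧ 𝔽 (LinAlg.Code2.C₂ 𝒞₂ j)) (LinAlg.⟦_⟧ 𝔽 (LinAlg.Code2.S₂ 𝒞₂))) →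
    Σ (Fin (count (LinAlg.Code1.inC₁ᶜ 𝒞₁) * count inC₂ᶜ) → LinAlg.Subspace 𝔽 (LinAlg.Construction.N 𝒞))
      λ 𝒞′ → LinAlg.Distinct 𝔽 𝒞′
        × (∀ s t → s ≢ t → LinAlg.Trivial 𝔽 (LinAlg.⟦_⟧ 𝔽 (𝒞′ s)) (LinAlg.⟦_⟧ 𝔽 (𝒞′ t)))
        × (∀ t → LinAlg.Construction.InC 𝒞 (LinAlg.⟦_⟧ 𝔽 (𝒞′ t)))
lemma5 q _ 𝔽 k v₁ v₂ 1≤k _ _ _ 𝒞₁ 𝒞₂ 𝒞 inC₂ᶜ C₂ᶜ-trivial C₂ᶜ-S₂-trivial =
  𝒞′ , trivial-distinct 𝒞′ (λ s → block-nonzero _ _ _) 𝒞′-trivial , 𝒞′-trivial , 𝒞′-in-𝒞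
  where
  open LinAlg 𝔽 using (Subspace; Trivial; ⟦_⟧)
  open LinAlg.Code1 𝒞₁ using (m₁; inC₁ᶜ)
  open LinAlg.Code2 𝒞₂ using (m₂)
  open LinAlg.Construction 𝒞 using (N; InC)
  open SubspaceFacts 𝔽 using (trivial-distinct)
  open Blocks 𝔽 k v₁ v₂ 1≤k 𝒞₁ 𝒞₂ 𝒞 inC₂ᶜ C₂ᶜ-trivial C₂ᶜ-S₂-trivial

  pair : Fin (count inC₁ᶜ * count inC₂ᶜ) → Fin m₁ × Fin m₂
  pair = enum-pairs inC₁ᶜ inC₂ᶜ

  member : ∀ s → inC₁ᶜ (proj₁ (pair s)) ≡ true × inC₂ᶜ (proj₂ (pair s)) ≡ true
  member = enum-pairs-true inC₁ᶜ inC₂ᶜ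

  𝒞′ : Fin (count inC₁ᶜ * count inC₂ᶜ) → Subspace N
  𝒞′ s = block (proj₁ (pair s)) (proj₁ (member s)) (proj₂ (pair s))

  𝒞′-trivial : ∀ s t → s ≢ t → Trivial ⟦ 𝒞′ s ⟧ ⟦ 𝒞′ t ⟧
  𝒞′-trivial s t s≢t =
    blocks-trivial _ _ _ _ _ _ (λ e → s≢t (enum-pairs-injective inC₁ᶜ inC₂ᶜ s t e))
      (proj₂ (member s)) (proj₂ (member t))

  𝒞′-in-𝒞 : ∀ s → InC ⟦ 𝒞′ s ⟧
  𝒞′-in-𝒞 s = block-in-𝒞 _ _ _ (proj₂ (member s))
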